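{- Let $G$ be a simple graph. For every vertex $P \in V(G)$ we have $H_r(P) \subseteq H_f(P)$.
   Context: A graph is a finite connected multigraph with no loop edges; a simple graph is a graph with no multiple edges and more than one vertex. $\mathbb{N}=\{0,1,2,\dots\}$. A divisor on $G$ is a formal integer combination $D=\sum_{Q\in V(G)} D(Q)\,Q$; $\deg D=\sum_Q D(Q)$; $D\ge D'$ means $D(Q)\ge D'(Q)$ for all $Q$; $D$ is effective if $D\ge 0$. Let $\mathcal{M}(G)$ be the set of functions $V(G)\to\mathbb{Z}$. The Laplacian of $f\in\mathcal{M}(G)$ is the divisor $\Delta f$ with $\Delta f(Q)=\sum_{e=QR\in E(G)}(f(Q)-f(R))$ (sum over edges incident to $Q$, counted with multiplicity). Divisors $D,D'$ are linearly equivalent if $D-D'=\Delta f$ for some $f$. For a divisor $D$, $|D|=\{E\ge 0: E\sim D\}$. The rank $r(D)$ is $-1$ if $|D|=\emptyset$, and otherwise the largest $k\in\mathbb{N}$ such that $|D-E|\neq\emptyset$ for every effective divisor $E$ of degree $k$. For $P\in V(G)$: the rank Weierstrass set is $H_r(P)=\{n\in\mathbb{N}: r(nP)>r((n-1)P)\}$, and the functional Weierstrass set is $H_f(P)=\{n\in\mathbb{N}:\exists f\in\mathcal{M}(G)\text{ with }\Delta f(P)=-n\text{ and }\Delta f(Q)\ge 0\ \forall Q\neq P\}$ (i.e. $f$ has a unique pole, of order $n$, at $P$). -}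

module Defs where

open import Data.Nat using (ℕ; suc; _≤_)
open import Data.Integer as ℤ using (ℤ; +_; -[1+_]; _-_; _<_)
open import Data.Bool using (Bool; true; false)
open import Data.Fin using (Fin)
open import Data.List using (List; map; foldr)
open import Data.List.Base using (allFin)
open import Data.Product using (Σ; _×_; ∃)
open import Data.Sum using (_⊎_)
open import Relation.Binary.PropositionalEquality using (_≡_)
open import Relation.Nullary using (¬_)

Σᵥ : ∀ {n} → (Fin n → ℤ) → ℤ
Σᵥ {n} g = foldr ℤ._+_ (+ 0) (map g (allFin n))

data Reach {n : ℕ} (adj : Fin n → Fin n → Bool) (u : Fin n) : Fin n → Set where
  here : Reach adj u u
  step : ∀ {v w} → Reach adj u v → adj v w ≡ true → Reach adj u w

record SimpleGraph : Set where
  field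
    n       : ℕ
    two≤n   : 2 ≤ n
    adj     : Fin n → Fin n → Bool
    adj-sym : ∀ u v → adj u v ≡ adj v u
    adj-irr : ∀ u → adj u u ≡ false

    connected : ∀ u v → Reach adj u v

module _ (G : SimpleGraph) where
  open SimpleGraph G

  Vertex : Set
  Vertex = Fin n

  Divisor : Set
  Divisor = Vertex → ℤ

  deg : Divisor → ℤ
  deg D = Σᵥ D

  Effective : Divisor → Set
  Effective D = ∀ Q → + 0 ℤ.≤ D Q

  mult : Vertex → Vertex → ℤ
  mult Q R with adj Q R
  ... | true  = + 1
  ... | false = + 0

  Δ : (Vertex → ℤ) → Divisor
  Δ f Q = Σᵥ (λ R → mult Q R ℤ.* (f Q - f R))

  _∼_ : Divisor → Divisor → Set
  D ∼ D' = Σ (Vertex → ℤ) λ f → ∀ Q → D Q - D' Q ≡ Δ f Q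

  _⊝_ : Divisor → Divisor → Divisor
  (D ⊝ E) Q = D Q - E Q

  LinSysNonempty : Divisor → Set
  LinSysNonempty D = Σ Divisor λ E → Effective E × E ∼ D

  RankAtLeast : Divisor → ℕ → Set
  RankAtLeast D k = ∀ E → Effective E → deg E ≡ + k → LinSysNonempty (D ⊝ E)

  HasRank : Divisor → ℤ → Set
  HasRank D r =
    (r ≡ -[1+ 0 ] × ¬ LinSysNonempty D)
    ⊎ (Σ ℕ λ k → r ≡ + k × LinSysNonempty D × RankAtLeast D k
                  × (∀ m → RankAtLeast D m → m ≤ k))

  _·_ : ℤ → Vertex → Divisor
  (m · P) Q with Q Data.Fin.≟ P
  ... | Relation.Nullary.yes _ = m
  ... | Relation.Nullary.no  _ = + 0

  InHr : Vertex → ℕ → Set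
  InHr P k = Σ ℤ λ r₁ → Σ ℤ λ r₀ →
    HasRank ((+ k) · P) r₁ × HasRank (((+ k) - + 1) · P) r₀ × r₀ < r₁

  InHf : Vertex → ℕ → Set
  InHf P k = Σ (Vertex → ℤ) λ f →
    Δ f P ≡ ℤ.- (+ k) × (∀ Q → ¬ Q ≡ P → + 0 ℤ.≤ Δ f Q)

-- Let r(kP) = k₁ ≥ 0, and let F be effective of degree k₁, so that E ∼ kP − F for some effective E.
-- We show by induction on F(P) that (k−1)P − F is winnable unless P is the only pole, of order k,
-- of some f. If E(P) ≥ 1, then E − P ∼ (k−1)P − F. If E(P) = F(P) = 0, the f with
-- E − (kP − F) = Δf is such a function. If F(P) > 0, reduce E with respect to P by Dhar's burning
-- algorithm: either E − P turns out winnable, or the P-reduced divisor X has X(P) = 0; since G is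
-- simple, the first vertex Q to catch fire then has X(Q) = 0, everything burns from Q, and E − Q is
-- unwinnable. Moving a chip of F from P to Q contradicts the induction hypothesis, because
-- (k−1)P − (F − P + Q) ∼ E − Q. So without such an f we would get r((k−1)P) ≥ k₁ = r(kP).
-- Effective divisors of degree k₁ are finitely many, which makes the case distinction constructive.

module Submission where

open import Data.Bool using (Bool; true; false; not; _∨_)
open import Data.Bool.Properties using (∨-zeroʳ; ¬-not)
open import Data.Empty using (⊥; ⊥-elim)
open import Data.Fin as Fin using (Fin; zero; suc)
open import Data.Fin.Properties using (suc-injective; all?; any?; ¬∀⟶∃¬)
open import Data.Integer as ℤ
  using (ℤ; ∣_∣; +_; -[1+_]; +[1+_]; _+_; _-_; -_; _*_; _≤_; _<_; _≤?_; _<?_; +≤+; +<+; -<+)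
open import Data.Integer.Properties
open import Data.Integer.Tactic.RingSolver using (solve-∀)
open import Data.List using (foldr; tabulate)
open import Data.List.Base using (allFin)
open import Data.List.Extrema ≤-totalOrder using (argmin; f[argmin]≤f[xs])
open import Data.List.Membership.Propositional.Properties using (∈-allFin)
open import Data.List.Properties using (map-tabulate)
import Data.List.Relation.Unary.All as List
open import Data.Nat as ℕ using (ℕ; zero; suc)
import Data.Nat.Properties as ℕ
open import Data.Product using (Σ; _×_; _,_; proj₁; proj₂)
open import Data.Sum using (_⊎_; inj₁; inj₂; [_,_]′; map₁)
open import Data.Vec as Vec using (Vec; []; _∷_)
open import Data.Vec.Properties using (lookup∘tabulate)
open import Data.Vec.Relation.Unary.All using (All; []; _∷_)
open import Data.Vec.Relation.Unary.All.Properties using (tabulate⁺)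
open import Function using (_∘_; id)
open import Relation.Binary.PropositionalEquality
open import Relation.Nullary using (¬_; ¬?; Dec; yes; no; does; _→-dec_; _×-dec_)
open import Relation.Nullary.Decidable using (dec-true; dec-false; decidable-stable)

open import Algebra.Properties.CommutativeMonoid.Sum +-0-commutativeMonoid
  using (sum; sum-cong-≗; sum-replicate-zero; ∑-distrib-+; ∑-comm)

open import Defs

i<j⇒i-j≤-1 : ∀ {i j} → i < j → i - j ≤ - + 1
i<j⇒i-j≤-1 {i} {j} i<j = subst (_≤ - + 1) (lemma i j) (+-monoˡ-≤ (- + 1) (i≤j⇒i-j≤0 (i<j⇒suc[i]≤j i<j)))
  where
  lemma : ∀ i j → (+ 1 + i - j) + - + 1 ≡ i - j
  lemma = solve-∀

i<j⇒i+k<0 : ∀ {i j k} → i < j → k ≤ - j → i + k < + 0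
i<j⇒i+k<0 {i} {j} {k} i<j k≤-j =
  ≤-<-trans (+-monoʳ-≤ i k≤-j) (subst (i - j <_) (+-inverseʳ j) (+-monoˡ-< (- j) i<j))

0≤i<1⇒i≡0 : ∀ {i} → + 0 ≤ i → i < + 1 → i ≡ + 0
0≤i<1⇒i≡0 {+ zero}   _ _                  = refl
0≤i<1⇒i≡0 {+[1+ _ ]} _ (+<+ (ℕ.s≤s ()))

i≡-i⇒i≡0 : ∀ {i} → i ≡ - i → i ≡ + 0
i≡-i⇒i≡0 {+ zero}   _  = refl
i≡-i⇒i≡0 {+[1+ _ ]} ()
i≡-i⇒i≡0 { -[1+ _ ]} ()

Σᵥ≡sum : ∀ {n} (g : Fin n → ℤ) → Σᵥ g ≡ sum g
Σᵥ≡sum g = trans (cong (foldr _+_ (+ 0)) (map-tabulate id g)) (foldr-tabulate g)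
  where
  foldr-tabulate : ∀ {m} (h : Fin m → ℤ) → foldr _+_ (+ 0) (tabulate h) ≡ sum h
  foldr-tabulate {zero}  h = refl
  foldr-tabulate {suc m} h = cong (_+_ (h zero)) (foldr-tabulate (h ∘ suc))

sum-neg : ∀ {n} (g : Fin n → ℤ) → sum (λ i → - g i) ≡ - sum g
sum-neg {zero}  g = refl
sum-neg {suc n} g = trans (cong (_+_ (- g zero)) (sum-neg (g ∘ suc))) (sym (neg-distrib-+ (g zero) _))

sum-mono-≤ : ∀ {n} {g h : Fin n → ℤ} → (∀ i → g i ≤ h i) → sum g ≤ sum h
sum-mono-≤ {zero}  g≤h = ≤-refl
sum-mono-≤ {suc n} g≤h = +-mono-≤ (g≤h zero) (sum-mono-≤ (g≤h ∘ suc))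

sum-mono-< : ∀ {n} {g h : Fin n → ℤ} → (∀ i → g i ≤ h i) → ∀ j → g j < h j → sum g < sum h
sum-mono-< {suc n} g≤h zero    gj<hj = +-mono-<-≤ gj<hj (sum-mono-≤ (g≤h ∘ suc))
sum-mono-< {suc n} g≤h (suc j) gj<hj = +-mono-≤-< (g≤h zero) (sum-mono-< (g≤h ∘ suc) j gj<hj)

sum-nonneg : ∀ {n} {g : Fin n → ℤ} → (∀ i → + 0 ≤ g i) → + 0 ≤ sum g
sum-nonneg {n} {g} g≥0 = subst (_≤ sum g) (sum-replicate-zero n) (sum-mono-≤ g≥0)

sum-nonpos : ∀ {n} {g : Fin n → ℤ} → (∀ i → g i ≤ + 0) → sum g ≤ + 0
sum-nonpos {n} {g} g≤0 = subst (sum g ≤_) (sum-replicate-zero n) (sum-mono-≤ g≤0)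

term≤sum : ∀ {n} (g : Fin n → ℤ) → (∀ i → + 0 ≤ g i) → ∀ j → g j ≤ sum g
term≤sum {suc n} g g≥0 zero    = i≤i+j (g zero) _ {{ℤ.nonNegative (sum-nonneg (g≥0 ∘ suc))}}
term≤sum {suc n} g g≥0 (suc j) =
  subst (_≤ sum g) (+-identityˡ (g (suc j))) (+-mono-≤ (g≥0 zero) (term≤sum (g ∘ suc) (g≥0 ∘ suc) j))

sum≤term : ∀ {n} (g : Fin n → ℤ) → (∀ i → g i ≤ + 0) → ∀ j → sum g ≤ g j
sum≤term g g≤0 j =
  subst₂ _≤_ (trans (cong -_ (sum-neg g)) (neg-involutive _)) (neg-involutive (g j))
    (neg-mono-≤ (term≤sum (λ i → - g i) (λ i → neg-mono-≤ (g≤0 i)) j))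

sum-single : ∀ {n} (g : Fin n → ℤ) (j : Fin n) → (∀ i → i ≢ j → g i ≡ + 0) → sum g ≡ g j
sum-single {suc n} g zero    g≡0 =
  trans (cong (_+_ (g zero)) (trans (sum-cong-≗ (λ i → g≡0 (suc i) λ ())) (sum-replicate-zero n))) (+-identityʳ _)
sum-single {suc n} g (suc j) g≡0 =
  trans (cong (_+ sum (g ∘ suc)) (g≡0 zero λ ()))
    (trans (+-identityˡ _) (sum-single (g ∘ suc) j (λ i i≢j → g≡0 (suc i) (i≢j ∘ suc-injective))))

sum-one : ∀ n → sum {n} (λ _ → + 1) ≡ + n
sum-one zero    = refl
sum-one (suc n) = cong (_+_ (+ 1)) (sum-one n)

when : Bool → ℤ → ℤ
when true  x = x
when false _ = + 0

when-nonneg : ∀ b {x} → + 0 ≤ x → + 0 ≤ when b x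
when-nonneg true  0≤x = 0≤x
when-nonneg false _   = ≤-refl

when-≤ : ∀ b {x} → + 0 ≤ x → when b x ≤ x
when-≤ true  _   = ≤-refl
when-≤ false 0≤x = 0≤x

when-mono : ∀ {b b'} x → + 0 ≤ x → (b ≡ true → b' ≡ true) → when b x ≤ when b' x
when-mono {true}  x _ b⇒b' rewrite b⇒b' refl = ≤-refl
when-mono {false} {true}  x 0≤x _ = 0≤x
when-mono {false} {false} x _   _ = ≤-refl

when-+ : ∀ b x y → when b (x + y) ≡ when b x + when b y
when-+ true  x y = refl
when-+ false x y = refl

when-split : ∀ b c y → when b y ≡ when b (when c y) + when b (when (not c) y)
when-split true  true  y = sym (+-identityʳ y)
when-split true  false y = sym (+-identityˡ y)
when-split false _     y = refl

when-neg-swap : ∀ b c y → when b (when c (- y)) ≡ - when c (when b y)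
when-neg-swap true  true  y = refl
when-neg-swap true  false y = refl
when-neg-swap false true  y = refl
when-neg-swap false false y = refl

sum-when : ∀ {n} b (h : Fin n → ℤ) → when b (sum h) ≡ sum (λ x → when b (h x))
sum-when true  h = refl
sum-when {n} false h = sym (sum-replicate-zero n)

¬[⇒]⇒true-false : ∀ {a b : Bool} → ¬ (a ≡ true → b ≡ true) → a ≡ true × b ≡ false
¬[⇒]⇒true-false {true}  {false} _   = refl , refl
¬[⇒]⇒true-false {_}     {true}  a⇏b = ⊥-elim (a⇏b λ _ → refl)
¬[⇒]⇒true-false {false} {_}     a⇏b = ⊥-elim (a⇏b λ ())

true⇒witness : ∀ {A : Set} (a? : Dec A) → does a? ≡ true → A
true⇒witness (yes a) _ = a

other-than : ∀ {m} → 2 ℕ.≤ m → (i : Fin m) → Σ (Fin m) λ j → j ≢ i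
other-than (ℕ.s≤s (ℕ.s≤s ℕ.z≤n)) zero    = suc zero , λ ()
other-than (ℕ.s≤s (ℕ.s≤s ℕ.z≤n)) (suc i) = zero , λ ()

∀≤-distrib-⊎ : ∀ {A : ℕ → Set} {B : Set} b →
               (∀ x → x ℕ.≤ b → A x ⊎ B) → (∀ x → x ℕ.≤ b → A x) ⊎ B
∀≤-distrib-⊎ zero h with h 0 ℕ.z≤n
... | inj₁ a = inj₁ λ { zero ℕ.z≤n → a }
... | inj₂ β = inj₂ β
∀≤-distrib-⊎ (suc b) h with ∀≤-distrib-⊎ b (λ x x≤b → h x (ℕ.m≤n⇒m≤1+n x≤b)) | h (suc b) ℕ.≤-refl
... | inj₂ β      | _      = inj₂ β
... | inj₁ _      | inj₂ β = inj₂ β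
... | inj₁ below  | inj₁ a = inj₁ λ x x≤1+b →
  [ (λ x<1+b → below x (ℕ.≤-pred x<1+b)) , (λ { refl → a }) ]′ (ℕ.m≤n⇒m<n∨m≡n x≤1+b)

∀All≤-distrib-⊎ : ∀ {m} {A : Vec ℕ m → Set} {B : Set} b →
                  (∀ t → All (ℕ._≤ b) t → A t ⊎ B) → (∀ t → All (ℕ._≤ b) t → A t) ⊎ B
∀All≤-distrib-⊎ {zero} b h with h [] []
... | inj₁ a = inj₁ λ { [] [] → a }
... | inj₂ β = inj₂ β
∀All≤-distrib-⊎ {suc m} {A} b h with ∀≤-distrib-⊎ {λ x → ∀ t → All (ℕ._≤ b) t → A (x ∷ t)} b
                                       (λ x x≤b → ∀All≤-distrib-⊎ b (λ t t≤b → h (x ∷ t) (x≤b ∷ t≤b)))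
... | inj₁ a = inj₁ λ { (x ∷ t) (x≤b ∷ t≤b) → a x x≤b t t≤b }
... | inj₂ β = inj₂ β

module _ (G : SimpleGraph) where
  open SimpleGraph G

  private
    V : Set
    V = Vertex G

  -- The Laplacian

  mult-sym : ∀ Q R → mult G Q R ≡ mult G R Q
  mult-sym Q R with adj Q R | adj R Q | adj-sym Q R
  ... | true  | true  | _ = refl
  ... | false | false | _ = refl

  mult-nonneg : ∀ Q R → + 0 ≤ mult G Q R
  mult-nonneg Q R with adj Q R
  ... | true  = +≤+ ℕ.z≤n
  ... | false = +≤+ ℕ.z≤n

  mult-adj : ∀ {Q R} → adj Q R ≡ true → mult G Q R ≡ + 1
  mult-adj {Q} {R} QR with adj Q R
  ... | true = refl

  mult≤1 : ∀ Q R → mult G Q R ≤ + 1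
  mult≤1 Q R with adj Q R
  ... | true  = ≤-refl
  ... | false = +≤+ ℕ.z≤n

  flow : (V → ℤ) → V → V → ℤ
  flow f u x = mult G u x * (f u - f x)

  Δ≡sum-flow : ∀ f u → Δ G f u ≡ sum (flow f u)
  Δ≡sum-flow f u = Σᵥ≡sum (flow f u)

  flow-antisym : ∀ f u x → flow f u x ≡ - flow f x u
  flow-antisym f u x = trans (cong (λ m → m * (f u - f x)) (mult-sym u x)) (lemma (mult G x u) (f u) (f x))
    where
    lemma : ∀ m a b → m * (a - b) ≡ - (m * (b - a))
    lemma = solve-∀

  flow-≤ : ∀ f {u x} c → f u - f x ≤ c → flow f u x ≤ mult G u x * c
  flow-≤ f {u} {x} c d≤c = *-monoˡ-≤-nonNeg (mult G u x) {{ℤ.nonNegative (mult-nonneg u x)}} d≤c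

  flow-nonpos : ∀ f {u x} → f u ≤ f x → flow f u x ≤ + 0
  flow-nonpos f {u} {x} fu≤fx = subst (flow f u x ≤_) (*-zeroʳ (mult G u x)) (flow-≤ f (+ 0) (i≤j⇒i-j≤0 fu≤fx))

  Δ-+ : ∀ f g u → Δ G (λ v → f v + g v) u ≡ Δ G f u + Δ G g u
  Δ-+ f g u = begin
    Δ G (λ v → f v + g v) u              ≡⟨ Δ≡sum-flow (λ v → f v + g v) u ⟩
    sum (flow (λ v → f v + g v) u)       ≡⟨ sum-cong-≗ (λ x → lemma (mult G u x) (f u) (g u) (f x) (g x)) ⟩
    sum (λ x → flow f u x + flow g u x)  ≡⟨ ∑-distrib-+ (flow f u) (flow g u) ⟩
    sum (flow f u) + sum (flow g u)      ≡⟨ sym (cong₂ _+_ (Δ≡sum-flow f u) (Δ≡sum-flow g u)) ⟩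
    Δ G f u + Δ G g u                    ∎
    where
    open ≡-Reasoning
    lemma : ∀ m a b c d → m * ((a + b) - (c + d)) ≡ m * (a - c) + m * (b - d)
    lemma = solve-∀

  Δ-neg : ∀ f u → Δ G (λ v → - f v) u ≡ - Δ G f u
  Δ-neg f u = begin
    Δ G (λ v → - f v) u          ≡⟨ Δ≡sum-flow (λ v → - f v) u ⟩
    sum (flow (λ v → - f v) u)   ≡⟨ sum-cong-≗ (λ x → lemma (mult G u x) (f u) (f x)) ⟩
    sum (λ x → - flow f u x)     ≡⟨ sum-neg (flow f u) ⟩
    - sum (flow f u)             ≡⟨ cong -_ (Δ≡sum-flow f u) ⟨
    - Δ G f u                    ∎
    where
    open ≡-Reasoning
    lemma : ∀ m a c → m * (- a - - c) ≡ - (m * (a - c))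
    lemma = solve-∀

  Δ-const : ∀ c u → Δ G (λ _ → c) u ≡ + 0
  Δ-const c u = trans (Δ≡sum-flow (λ _ → c) u) (trans (sum-cong-≗ (λ x → lemma (mult G u x) c)) (sum-replicate-zero n))
    where
    lemma : ∀ m c → m * (c - c) ≡ + 0
    lemma = solve-∀

  Δ-minus : ∀ f g u → Δ G (λ v → f v - g v) u ≡ Δ G f u - Δ G g u
  Δ-minus f g u = trans (Δ-+ f (λ v → - g v) u) (cong (_+_ (Δ G f u)) (Δ-neg g u))

  sum-Δ≡boundary-flow : ∀ (T : V → Bool) f →
    sum (λ u → when (T u) (Δ G f u)) ≡ sum (λ u → sum (λ x → when (T u) (when (not (T x)) (flow f u x))))
  sum-Δ≡boundary-flow T f = begin
    sum (λ u → when (T u) (Δ G f u))                          ≡⟨ sum-cong-≗ split ⟩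
    sum (λ u → sum (inner u) + sum (boundary u))              ≡⟨ ∑-distrib-+ (sum ∘ inner) (sum ∘ boundary) ⟩
    sum (λ u → sum (inner u)) + sum (λ u → sum (boundary u))  ≡⟨ cong (_+ sum (sum ∘ boundary)) inner≡0 ⟩
    + 0 + sum (λ u → sum (boundary u))                        ≡⟨ +-identityˡ (sum (sum ∘ boundary)) ⟩
    sum (λ u → sum (boundary u))                              ∎
    where
    open ≡-Reasoning
    inner boundary : V → V → ℤ
    inner    u x = when (T u) (when (T x) (flow f u x))
    boundary u x = when (T u) (when (not (T x)) (flow f u x))
    split : ∀ u → when (T u) (Δ G f u) ≡ sum (inner u) + sum (boundary u)
    split u = trans (cong (when (T u)) (Δ≡sum-flow f u))
      (trans (sum-when (T u) (flow f u))
        (trans (sum-cong-≗ (λ x → when-split (T u) (T x) (flow f u x))) (∑-distrib-+ (inner u) (boundary u))))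
    -- Flows between two vertices of T cancel in pairs.
    inner≡-inner : sum (λ u → sum (inner u)) ≡ - sum (λ u → sum (inner u))
    inner≡-inner = trans (∑-comm inner) (trans (sum-cong-≗ λ x →
      trans (sum-cong-≗ λ u → trans (cong (λ y → when (T u) (when (T x) y)) (flow-antisym f u x))
                                    (when-neg-swap (T u) (T x) (flow f x u)))
        (sum-neg (inner x))) (sum-neg (λ x → sum (inner x))))
    inner≡0 : sum (λ u → sum (inner u)) ≡ + 0
    inner≡0 = i≡-i⇒i≡0 inner≡-inner

  -- Winnable divisors

  pt : V → Divisor G
  pt Q = _·_ G (+ 1) Q

  ·-self : ∀ m Q → _·_ G m Q Q ≡ m
  ·-self m Q with Q Fin.≟ Q
  ... | yes _   = refl
  ... | no Q≢Q = ⊥-elim (Q≢Q refl)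

  ·-other : ∀ m Q {u} → u ≢ Q → _·_ G m Q u ≡ + 0
  ·-other m Q {u} u≢Q with u Fin.≟ Q
  ... | yes u≡Q = ⊥-elim (u≢Q u≡Q)
  ... | no _    = refl

  ·-effective : ∀ k Q → Effective G (_·_ G (+ k) Q)
  ·-effective k Q u with u Fin.≟ Q
  ... | yes _ = +≤+ ℕ.z≤n
  ... | no _  = +≤+ ℕ.z≤n

  deg-· : ∀ m Q → deg G (_·_ G m Q) ≡ m
  deg-· m Q = trans (Σᵥ≡sum (_·_ G m Q)) (trans (sum-single (_·_ G m Q) Q (λ _ → ·-other m Q)) (·-self m Q))

  ·-pred : ∀ m Q u → _·_ G (m - + 1) Q u ≡ _·_ G m Q u - pt Q u
  ·-pred m Q u with u Fin.≟ Q
  ... | yes _ = refl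
  ... | no _  = refl

  ⊝-point-effective : ∀ {X} Q → Effective G X → + 1 ≤ X Q → Effective G (_⊝_ G X (pt Q))
  ⊝-point-effective {X} Q X≥0 1≤XQ u with u Fin.≟ Q
  ... | yes refl = i≤j⇒0≤j-i 1≤XQ
  ... | no  _    = subst (+ 0 ≤_) (sym (+-identityʳ (X u))) (X≥0 u)

  _+Δ_ : Divisor G → (V → ℤ) → Divisor G
  (D +Δ g) u = D u + Δ G g u

  Winnable : Divisor G → Set
  Winnable D = Σ (V → ℤ) λ g → Effective G (D +Δ g)

  winnable⇒nonempty : ∀ {D} → Winnable D → LinSysNonempty G D
  winnable⇒nonempty {D} (g , eff) = D +Δ g , eff , g , λ u → lemma (D u) (Δ G g u)
    where
    lemma : ∀ d x → (d + x) - d ≡ x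
    lemma = solve-∀

  effective⇒winnable : ∀ {D} → Effective G D → Winnable D
  effective⇒winnable {D} D≥0 = (λ _ → + 0) , λ u →
    subst (+ 0 ≤_) (sym (trans (cong (_+_ (D u)) (Δ-const (+ 0) u)) (+-identityʳ (D u)))) (D≥0 u)

  winnable-≗ : ∀ {D D'} → (∀ u → D u ≡ D' u) → Winnable D → Winnable D'
  winnable-≗ D≗D' (g , X-Q+Δg≥0) = g , λ u → subst (λ d → + 0 ≤ d + Δ G g u) (D≗D' u) (X-Q+Δg≥0 u)

  winnable-∼ : ∀ {D D'} → _∼_ G D D' → Winnable D → Winnable D'
  winnable-∼ {D} {D'} (f , D-D'≡Δf) (g , eff) = (λ v → g v + f v) , λ u →
    subst (+ 0 ≤_) (trans (lemma (D u) (D' u) (Δ G g u) (Δ G f u) (D-D'≡Δf u)) (cong (_+_ (D' u)) (sym (Δ-+ g f u)))) (eff u)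
    where
    lemma : ∀ d d' x y → d - d' ≡ y → d + x ≡ d' + (x + y)
    lemma d d' x y e = trans (rearrange d d' x) (cong (λ z → d' + (x + z)) e)
      where
      rearrange : ∀ d d' x → d + x ≡ d' + (x + (d - d'))
      rearrange = solve-∀

  -- Bounds on firing scripts

  deg-nonneg : ∀ {E} → Effective G E → + 0 ≤ deg G E
  deg-nonneg {E} E≥0 = subst (+ 0 ≤_) (sym (Σᵥ≡sum E)) (sum-nonneg E≥0)

  -- Sum E + Δf over the sublevel set T = {f ≤ f w}: the part Δf is a net flow out of T, and the edge w v leaves T.
  edge-bound : ∀ {E} f → Effective G E → Effective G (E +Δ f) → ∀ {v w} → adj v w ≡ true → f v - f w ≤ deg G E
  edge-bound {E} f E≥0 E+Δf≥0 {v} {w} vw with f v ≤? f w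
  ... | yes fv≤fw = ≤-trans (i≤j⇒i-j≤0 fv≤fw) (deg-nonneg E≥0)
  ... | no  fv≰fw =
    0≤i-j⇒j≤i (subst (+ 0 ≤_) (lemma (deg G E) (f v) (f w)) (≤-trans 0≤E+Δf (+-mono-≤ E-over≤deg Δf-over≤)))
    where
    lemma : ∀ d a b → d + (b - a) ≡ d - (a - b)
    lemma = solve-∀
    T : V → Bool
    T u = does (f u ≤? f w)
    boundary : V → V → ℤ
    boundary u x = when (T u) (when (not (T x)) (flow f u x))
    boundary≤0 : ∀ u x → boundary u x ≤ + 0
    boundary≤0 u x with f u ≤? f w | f x ≤? f w
    ... | yes _     | yes _     = ≤-refl
    ... | yes fu≤fw | no  fx≰fw = flow-nonpos f (≤-trans fu≤fw (<⇒≤ (≰⇒> fx≰fw)))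
    ... | no  _     | _         = ≤-refl
    boundary-wv : boundary w v ≡ f w - f v
    boundary-wv with f w ≤? f w | f v ≤? f w
    ... | no  fw≰fw | _         = ⊥-elim (fw≰fw ≤-refl)
    ... | yes _     | yes fv≤fw = ⊥-elim (fv≰fw fv≤fw)
    ... | yes _     | no  _     = trans (cong (_* (f w - f v)) (trans (mult-sym w v) (mult-adj vw))) (*-identityˡ _)
    E-over Δf-over : ℤ
    E-over  = sum (λ u → when (T u) (E u))
    Δf-over = sum (λ u → when (T u) (Δ G f u))
    0≤E+Δf : + 0 ≤ E-over + Δf-over
    0≤E+Δf = subst (+ 0 ≤_) (trans (sum-cong-≗ λ u → when-+ (T u) (E u) (Δ G f u))
                                   (∑-distrib-+ (λ u → when (T u) (E u)) (λ u → when (T u) (Δ G f u))))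
                   (sum-nonneg λ u → when-nonneg (T u) (E+Δf≥0 u))
    E-over≤deg : E-over ≤ deg G E
    E-over≤deg = subst (E-over ≤_) (sym (Σᵥ≡sum E)) (sum-mono-≤ λ u → when-≤ (T u) (E≥0 u))
    Δf-over≤ : Δf-over ≤ f w - f v
    Δf-over≤ = subst (_≤ f w - f v) (sym (sum-Δ≡boundary-flow T f))
      (≤-trans (sum≤term (sum ∘ boundary) (λ u → sum-nonpos (boundary≤0 u)) w)
        (subst (sum (boundary w) ≤_) boundary-wv (sum≤term (boundary w) (boundary≤0 w) v)))

  len : ∀ {u v} → Reach adj u v → ℕ
  len here       = 0
  len (step r _) = suc (len r)

  path-bound : ∀ (g : V → ℤ) d → (∀ {a b} → adj a b ≡ true → g a - g b ≤ d) →
               ∀ {u v} (r : Reach adj u v) → g u - g v ≤ d * + len r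
  path-bound g d edge {u} here = subst₂ _≤_ (sym (+-inverseʳ (g u))) (sym (*-zeroʳ d)) ≤-refl
  path-bound g d edge {u} (step {v} {w} r vw) =
    subst₂ _≤_ (lemma₁ (g u) (g v) (g w)) (sym (lemma₂ d (+ len r))) (+-mono-≤ (path-bound g d edge r) (edge vw))
    where
    lemma₁ : ∀ a b c → (a - b) + (b - c) ≡ a - c
    lemma₁ = solve-∀
    lemma₂ : ∀ d l → d * (+ 1 + l) ≡ d * l + d
    lemma₂ = solve-∀

  -- Dhar's burning algorithm

  _⊆_ : (V → Bool) → (V → Bool) → Set
  C ⊆ C' = ∀ v → C v ≡ true → C' v ≡ true

  ⁅_⁆ : V → V → Bool
  ⁅ s ⁆ v = does (v Fin.≟ s)

  ∈⁅⁆ : ∀ s → ⁅ s ⁆ s ≡ true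
  ∈⁅⁆ s = dec-true (s Fin.≟ s) refl

  ∈⁅⁆⇒≡ : ∀ {s v} → ⁅ s ⁆ v ≡ true → v ≡ s
  ∈⁅⁆⇒≡ {s} {v} = true⇒witness (v Fin.≟ s)

  ∉⁅⁆ : ∀ {s v} → v ≢ s → ⁅ s ⁆ v ≡ false
  ∉⁅⁆ {s} {v} = dec-false (v Fin.≟ s)

  neighboursIn : (V → Bool) → V → ℤ
  neighboursIn C v = sum (λ x → when (C x) (mult G v x))

  neighboursIn-mono : ∀ {C C'} → C ⊆ C' → ∀ v → neighboursIn C v ≤ neighboursIn C' v
  neighboursIn-mono C⊆C' v = sum-mono-≤ λ x → when-mono (mult G v x) (mult-nonneg v x) (C⊆C' x)

  neighboursIn-⁅⁆ : ∀ s v → neighboursIn ⁅ s ⁆ v ≡ mult G v s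
  neighboursIn-⁅⁆ s v =
    trans (sum-single _ s (λ x x≢s → cong (λ b → when b (mult G v x)) (∉⁅⁆ x≢s)))
          (cong (λ b → when b (mult G v s)) (∈⁅⁆ s))

  burnStep : (V → ℤ) → (V → Bool) → V → Bool
  burnStep X C v = C v ∨ does (X v <? neighboursIn C v)

  burn : (V → ℤ) → V → ℕ → V → Bool
  burn X s zero    = ⁅ s ⁆
  burn X s (suc j) = burnStep X (burn X s j)

  burnStep-inflationary : ∀ X C → C ⊆ burnStep X C
  burnStep-inflationary X C v Cv rewrite Cv = refl

  burnStep-catches : ∀ X C {v} → X v < neighboursIn C v → burnStep X C v ≡ true
  burnStep-catches X C {v} Xv<nb rewrite dec-true (X v <? neighboursIn C v) Xv<nb = ∨-zeroʳ (C v)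

  burnStep-caught : ∀ X C {v} → burnStep X C v ≡ true → C v ≡ true ⊎ X v < neighboursIn C v
  burnStep-caught X C {v} burnt with C v
  ... | true  = inj₁ refl
  ... | false = inj₂ (true⇒witness (X v <? neighboursIn C v) burnt)

  burnStep-spares : ∀ X C {v} → burnStep X C v ≡ false → neighboursIn C v ≤ X v
  burnStep-spares X C {v} unburnt with C v | X v <? neighboursIn C v | unburnt
  ... | true  | _        | ()
  ... | false | yes _    | ()
  ... | false | no Xv≮nb | _  = ≮⇒≥ Xv≮nb

  burnStep-mono : ∀ X {C C'} → C ⊆ C' → burnStep X C ⊆ burnStep X C'
  burnStep-mono X {C} {C'} C⊆C' v burnt with C v in Cv | X v <? neighboursIn C v
  ... | true  | _      = burnStep-inflationary X C' v (C⊆C' v Cv)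
  ... | false | yes lt = burnStep-catches X C' (<-≤-trans lt (neighboursIn-mono C⊆C' v))

  Stable : (V → ℤ) → (V → Bool) → Set
  Stable X C = burnStep X C ⊆ C

  _⊆?_ : ∀ C C' → Dec (C ⊆ C')
  C ⊆? C' = all? λ v → (C v Data.Bool.≟ true) →-dec (C' v Data.Bool.≟ true)

  size : (V → Bool) → ℤ
  size C = sum (λ v → when (C v) (+ 1))

  size≤n : ∀ C → size C ≤ + n
  size≤n C = subst (size C ≤_) (sum-one n) (sum-mono-≤ λ v → when-≤ (C v) (+≤+ ℕ.z≤n))

  size-grows : ∀ {C C'} → C ⊆ C' → ¬ C' ⊆ C → size C < size C'
  size-grows {C} {C'} C⊆C' C'⊈C with ¬∀⟶∃¬ n _ (λ v → (C' v Data.Bool.≟ true) →-dec (C v Data.Bool.≟ true)) C'⊈C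
  ... | v , v∉ = let C'v , Cv = ¬[⇒]⇒true-false v∉ in
    sum-mono-< (λ u → when-mono (+ 1) (+≤+ ℕ.z≤n) (C⊆C' u)) v
      (subst₂ (λ b b' → when b (+ 1) < when b' (+ 1)) (sym Cv) (sym C'v) (+<+ ℕ.z<s))

  burn-grows : ∀ X s j → Stable X (burn X s j) ⊎ + suc j ≤ size (burn X s j)
  burn-grows X s zero = inj₂ (subst (_≤ size ⁅ s ⁆) (cong (λ b → when b (+ 1)) (∈⁅⁆ s))
    (term≤sum (λ v → when (⁅ s ⁆ v) (+ 1)) (λ v → when-nonneg (⁅ s ⁆ v) (+≤+ ℕ.z≤n)) s))
  burn-grows X s (suc j) with burn X s (suc j) ⊆? burn X s j | burn-grows X s j
  ... | yes stable  | _           = inj₁ (burnStep-mono X stable)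
  ... | no unstable | inj₁ stable = ⊥-elim (unstable stable)
  ... | no unstable | inj₂ j<size =
    inj₂ (≤-trans (+-monoʳ-≤ (+ 1) j<size) (i<j⇒suc[i]≤j (size-grows (burnStep-inflationary X (burn X s j)) unstable)))

  burn-stabilises : ∀ X s → Stable X (burn X s n)
  burn-stabilises X s with burn-grows X s n
  ... | inj₁ stable   = stable
  ... | inj₂ n<size   = ⊥-elim (<⇒≱ (suc[i]≤j⇒i<j n<size) (size≤n (burn X s n)))

  ∈burn : ∀ X s j → burn X s j s ≡ true
  ∈burn X s zero    = ∈⁅⁆ s
  ∈burn X s (suc j) = burnStep-inflationary X (burn X s j) s (∈burn X s j)

  minimiser : (g : V → ℤ) → V → Σ V λ i → ∀ j → g i ≤ g j
  minimiser g s = argmin g s (allFin n) , λ j → List.lookup (f[argmin]≤f[xs] s (allFin n)) (∈-allFin j)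

  Δ-at-min : ∀ g C {x} → (∀ R → g x ≤ g R) → (∀ R → C R ≡ true → g x < g R) → Δ G g x ≤ - neighboursIn C x
  Δ-at-min g C {x} x-min C-above =
    subst₂ _≤_ (sym (Δ≡sum-flow g x)) (sum-neg (λ R → when (C R) (mult G x R)))
      (sum-mono-≤ λ R → flow-at-min R (C R) (C-above R))
    where
    flow-at-min : ∀ R b → (b ≡ true → g x < g R) → flow g x R ≤ - when b (mult G x R)
    flow-at-min R false _     = flow-nonpos g (x-min R)
    flow-at-min R true  above = subst (flow g x R ≤_) (m*-1≡-m (mult G x R)) (flow-≤ g (- + 1) (i<j⇒i-j≤-1 (above refl)))
      where
      m*-1≡-m : ∀ m → m * - + 1 ≡ - m
      m*-1≡-m = solve-∀

  -- Were g a winning firing script, a burnt vertex could not be a minimum of g: there Δg would be at most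
  -- minus the number of its burning neighbours, which exceeds its chips.
  all-burnt⇒unwinnable : ∀ X Q N → X Q ≡ + 0 → (∀ v → burn X Q N v ≡ true) → ¬ Winnable (_⊝_ G X (pt Q))
  all-burnt⇒unwinnable X Q N XQ≡0 all-burnt (g , X-Q+Δg≥0) = <-irrefl refl (burnt⇒above-min N i (all-burnt i))
    where
    i : V
    i = proj₁ (minimiser g Q)
    i-min : ∀ R → g i ≤ g R
    i-min = proj₂ (minimiser g Q)
    above-min-unless : ∀ x → ((∀ R → g x ≤ g R) → ⊥) → g i < g x
    above-min-unless x not-min with g i <? g x
    ... | yes gi<gx = gi<gx
    ... | no  gi≮gx = ⊥-elim (not-min λ R → ≤-trans (≮⇒≥ gi≮gx) (i-min R))
    burnt⇒above-min : ∀ j x → burn X Q j x ≡ true → g i < g x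
    burnt⇒above-min zero x burnt with ∈⁅⁆⇒≡ {Q} {x} burnt
    ... | refl = above-min-unless Q λ Q-min →
      <⇒≱ (i<j⇒i+k<0 (subst₂ (λ a c → a - c < + 0) (sym XQ≡0) (sym (·-self (+ 1) Q)) -<+)
                     (subst (_≤ + 0) (sym (Δ≡sum-flow g Q)) (sum-nonpos λ R → flow-nonpos g (Q-min R))))
          (X-Q+Δg≥0 Q)
    burnt⇒above-min (suc j) x burnt with burnStep-caught X (burn X Q j) burnt
    ... | inj₁ x∈    = burnt⇒above-min j x x∈
    ... | inj₂ caught = above-min-unless x λ x-min →
      <⇒≱ (i<j⇒i+k<0 (≤-<-trans (i-j≤i (X x) (pt Q x) {{ℤ.nonNegative (·-effective 1 Q x)}}) caught)
                     (Δ-at-min g (burn X Q j) x-min λ R R∈ → ≤-<-trans (x-min i) (burnt⇒above-min j R R∈)))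
          (X-Q+Δg≥0 x)

  unburnt : (V → Bool) → V → ℤ
  unburnt B v = when (not (B v)) (+ 1)

  Δ-unburnt-burnt : ∀ B {u} → B u ≡ true → Δ G (unburnt B) u ≤ + 0
  Δ-unburnt-burnt B {u} Bu = subst (_≤ + 0) (sym (Δ≡sum-flow (unburnt B) u)) (sum-nonpos λ R →
    flow-nonpos (unburnt B) (subst (λ b → when (not b) (+ 1) ≤ unburnt B R) (sym Bu) (when-nonneg (not (B R)) (+≤+ ℕ.z≤n))))

  Δ-unburnt-unburnt : ∀ B {u} → B u ≡ false → Δ G (unburnt B) u ≡ neighboursIn B u
  Δ-unburnt-unburnt B {u} Bu = trans (Δ≡sum-flow (unburnt B) u) (sum-cong-≗ flow≡)
    where
    flow≡ : ∀ R → flow (unburnt B) u R ≡ when (B R) (mult G u R)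
    flow≡ R rewrite Bu with B R
    ... | true  = *-identityʳ (mult G u R)
    ... | false = *-zeroʳ (mult G u R)

  fire-unburnt : ∀ X B → Stable X B → Effective G X → Effective G (λ u → X u - Δ G (unburnt B) u)
  fire-unburnt X B stable X≥0 u = fire (B u) refl
    where
    fire : ∀ b → B u ≡ b → + 0 ≤ X u - Δ G (unburnt B) u
    fire true  Bu = ≤-trans (X≥0 u) (subst (_≤ X u - Δ G (unburnt B) u) (+-identityʳ (X u))
                                   (+-monoʳ-≤ (X u) (neg-mono-≤ (Δ-unburnt-burnt B Bu))))
    fire false Bu = subst (λ d → + 0 ≤ X u - d) (sym (Δ-unburnt-unburnt B Bu)) (i≤j⇒0≤j-i (burnStep-spares X B spared))
      where
      spared : burnStep X B u ≡ false
      spared with burnStep X B u in burnt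
      ... | true  = trans (sym (stable u burnt)) Bu
      ... | false = refl

  burn-stuck : ∀ X s → burn X s 1 ⊆ ⁅ s ⁆ → ∀ j → burn X s j ⊆ ⁅ s ⁆
  burn-stuck X s stuck zero    v burnt = burnt
  burn-stuck X s stuck (suc j) v burnt = stuck v (burnStep-mono X (burn-stuck X s stuck j) v burnt)

  -- The simplicity of G enters here: the first vertex Q to catch fire from P has X Q < mult Q P ≤ 1.
  fire-spreads : ∀ X P → Effective G X → X P ≡ + 0 → (∀ v → burn X P n v ≡ true) →
                 Σ V λ Q → Q ≢ P × X Q ≡ + 0 × (∀ v → burn X Q (suc n) v ≡ true)
  fire-spreads X P X≥0 XP≡0 all-burnt with any? (λ Q → (burn X P 1 Q Data.Bool.≟ true) ×-dec ¬? (Q Fin.≟ P))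
  ... | yes (Q , Q-burnt , Q≢P) = Q , Q≢P , XQ≡0 , λ v → burn-from-Q n v (all-burnt v)
    where
    XQ<mult : X Q < mult G Q P
    XQ<mult with burnStep-caught X ⁅ P ⁆ Q-burnt
    ... | inj₁ Q∈⁅P⁆ = ⊥-elim (Q≢P (∈⁅⁆⇒≡ Q∈⁅P⁆))
    ... | inj₂ caught = subst (X Q <_) (neighboursIn-⁅⁆ P Q) caught
    XQ≡0 : X Q ≡ + 0
    XQ≡0 = 0≤i<1⇒i≡0 (X≥0 Q) (<-≤-trans XQ<mult (mult≤1 Q P))
    P-catches : burn X Q 1 P ≡ true
    P-catches = burnStep-catches X ⁅ Q ⁆ (subst₂ _<_ (sym XP≡0) (sym (trans (neighboursIn-⁅⁆ Q P) (mult-sym P Q)))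
                                           (subst (_< mult G Q P) XQ≡0 XQ<mult))
    burn-from-Q : ∀ j → burn X P j ⊆ burn X Q (suc j)
    burn-from-Q zero    v v∈⁅P⁆ = subst (λ w → burn X Q 1 w ≡ true) (sym (∈⁅⁆⇒≡ v∈⁅P⁆)) P-catches
    burn-from-Q (suc j) = burnStep-mono X (burn-from-Q j)
  ... | no no-escape = ⊥-elim (R≢P (∈⁅⁆⇒≡ (burn-stuck X P stuck n R (all-burnt R))))
    where
    R : V
    R = proj₁ (other-than two≤n P)
    R≢P : R ≢ P
    R≢P = proj₂ (other-than two≤n P)
    stuck : burn X P 1 ⊆ ⁅ P ⁆
    stuck v burnt = subst (λ w → ⁅ P ⁆ w ≡ true)
      (sym (decidable-stable (v Fin.≟ P) λ v≢P → no-escape (v , burnt , v≢P))) (∈⁅⁆ P)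

  -- Reduction of E towards its P-reduced representative by repeatedly firing the set left unburnt by Dhar's algorithm.
  module Reduction (P : V) (E : Divisor G) (E≥0 : Effective G E) where

    Result : Set
    Result = Winnable (_⊝_ G E (pt P)) ⊎ Σ V λ Q → Q ≢ P × ¬ Winnable (_⊝_ G E (pt Q))

    Invariant : (V → ℤ) → Set
    Invariant f = f P ≡ + 0 × Effective G (E +Δ f)

    -- The edge bound along the path from P makes each summand nonnegative.
    potential : (V → ℤ) → ℤ
    potential f = sum (λ v → f v + deg G E * + len (connected P v))

    potential-nonneg : ∀ f → Invariant f → + 0 ≤ potential f
    potential-nonneg f (fP≡0 , E+Δf≥0) = sum-nonneg λ v →
      subst (+ 0 ≤_) (rearrange (f v) (deg G E * + len (connected P v)))
        (i≤j⇒0≤j-i (path-bound f (deg G E) (edge-bound f E≥0 E+Δf≥0) (connected P v)))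
      where
      rearrange : ∀ x c → c - (f P - x) ≡ x + c
      rearrange x c = trans (cong (λ p → c - (p - x)) fP≡0) (lemma x c)
        where
        lemma : ∀ x c → c - (+ 0 - x) ≡ x + c
        lemma = solve-∀

    Progress : (V → ℤ) → Set
    Progress f = Σ (V → ℤ) λ f' → Invariant f' × potential f' < potential f

    reduced : ∀ f → Invariant f → + 1 ≤ (E +Δ f) P → Result
    reduced f (_ , X≥0) 1≤XP = inj₁ (f , λ u →
      subst (+ 0 ≤_) (lemma (E u) (Δ G f u) (pt P u)) (⊝-point-effective P X≥0 1≤XP u))
      where
      lemma : ∀ e d c → (e + d) - c ≡ (e - c) + d
      lemma = solve-∀

    all-burnt : ∀ f → Invariant f → (E +Δ f) P ≡ + 0 → (∀ v → burn (E +Δ f) P n v ≡ true) → Result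
    all-burnt f (_ , X≥0) XP≡0 burnt = let Q , Q≢P , XQ≡0 , burnt-from-Q = fire-spreads X P X≥0 XP≡0 burnt in
      inj₂ (Q , Q≢P , λ win →
        all-burnt⇒unwinnable X Q (suc n) XQ≡0 burnt-from-Q (winnable-∼ {_⊝_ G E (pt Q)} ((λ v → - f v) , shift Q) win))
      where
      X : Divisor G
      X = E +Δ f
      shift : ∀ Q u → (E u - pt Q u) - (X u - pt Q u) ≡ Δ G (λ v → - f v) u
      shift Q u = trans (lemma (E u) (Δ G f u) (pt Q u)) (sym (Δ-neg f u))
        where
        lemma : ∀ e d c → (e - c) - ((e + d) - c) ≡ - d
        lemma = solve-∀

    fire : ∀ f → Invariant f → ∀ w → burn (E +Δ f) P n w ≡ false → Progress f
    fire f (fP≡0 , X≥0) w unburnt-w = f' , (f'P≡0 , E+Δf'≥0) , sum-mono-< (λ v → +-monoˡ-≤ _ (f'≤f v)) w f'w<fw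
      where
      X : Divisor G
      X = E +Δ f
      B : V → Bool
      B = burn X P n
      f' : V → ℤ
      f' v = f v - unburnt B v
      f'P≡0 : f' P ≡ + 0
      f'P≡0 = cong₂ (λ a b → a - when (not b) (+ 1)) fP≡0 (∈burn X P n)
      E+Δf'≥0 : Effective G (E +Δ f')
      E+Δf'≥0 u = subst (+ 0 ≤_) (trans (+-assoc (E u) (Δ G f u) (- Δ G (unburnt B) u))
                                        (cong (_+_ (E u)) (sym (Δ-minus f (unburnt B) u))))
                    (fire-unburnt X B (burn-stabilises X P) X≥0 u)
      f'≤f : ∀ v → f' v ≤ f v
      f'≤f v = i-j≤i (f v) (unburnt B v) {{ℤ.nonNegative (when-nonneg (not (B v)) (+≤+ ℕ.z≤n))}}
      f'w<fw : f' w + deg G E * + len (connected P w) < f w + deg G E * + len (connected P w)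
      f'w<fw = +-monoˡ-< _ (subst (λ b → f w - when (not b) (+ 1) < f w) (sym unburnt-w) (lemma (f w)))
        where
        lemma : ∀ x → x - + 1 < x
        lemma x = suc[i]≤j⇒i<j (≤-reflexive (cancel x))
          where
          cancel : ∀ x → + 1 + (x - + 1) ≡ x
          cancel = solve-∀

    reduce-step : ∀ f → Invariant f → Result ⊎ Progress f
    reduce-step f inv@(_ , X≥0) with + 1 ≤? (E +Δ f) P
    ... | yes 1≤XP = inj₁ (reduced f inv 1≤XP)
    ... | no  1≰XP with all? (λ v → burn (E +Δ f) P n v Data.Bool.≟ true)
    ...   | yes burnt = inj₁ (all-burnt f inv (0≤i<1⇒i≡0 (X≥0 P) (≰⇒> 1≰XP)) burnt)
    ...   | no  not-all = let w , w-unburnt = ¬∀⟶∃¬ n _ (λ v → burn (E +Δ f) P n v Data.Bool.≟ true) not-all in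
      inj₂ (fire f inv w (¬-not w-unburnt))

    reduce : ∀ fuel f → Invariant f → potential f ≤ + fuel → Result
    reduce fuel f inv bound with reduce-step f inv
    ... | inj₁ result = result
    reduce zero       f inv bound | inj₂ (f' , inv' , decreased) =
      ⊥-elim (<⇒≱ (<-≤-trans decreased bound) (potential-nonneg f' inv'))
    reduce (suc fuel) f inv bound | inj₂ (f' , inv' , decreased) =
      reduce fuel f' inv' (i<j⇒i≤pred[j] (<-≤-trans decreased bound))

    reduction : Result
    reduction = reduce ∣ potential 0ᶠ ∣ 0ᶠ inv₀ (≤-reflexive (sym (0≤i⇒+∣i∣≡i (potential-nonneg 0ᶠ inv₀))))
      where
      0ᶠ : V → ℤ
      0ᶠ _ = + 0
      inv₀ : Invariant 0ᶠ
      inv₀ = refl , proj₂ (effective⇒winnable E≥0)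

  reduce-or-escape : ∀ P E → Effective G E →
                     Winnable (_⊝_ G E (pt P)) ⊎ Σ V λ Q → Q ≢ P × ¬ Winnable (_⊝_ G E (pt Q))
  reduce-or-escape = Reduction.reduction

  -- Descent on the chips of F at P

  winnable-lower : ∀ {P k F E} → _∼_ G E (_⊝_ G (_·_ G (+ k) P) F) →
                   Winnable (_⊝_ G E (pt P)) → Winnable (_⊝_ G (_·_ G (+ k - + 1) P) F)
  winnable-lower {P} {k} {F} {E} (f , E-D≡Δf) = winnable-∼ {_⊝_ G E (pt P)} (f , λ u →
    trans (cong (λ c → (E u - pt P u) - (c - F u)) (·-pred (+ k) P u))
          (trans (lemma (E u) (_·_ G (+ k) P u) (pt P u) (F u)) (E-D≡Δf u)))
    where
    lemma : ∀ e p c x → (e - c) - ((p - c) - x) ≡ e - (p - x)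
    lemma = solve-∀

  moveChip : V → V → Divisor G → Divisor G
  moveChip P Q F u = F u - pt P u + pt Q u

  moveChip-effective : ∀ {P Q F} → Effective G F → + 1 ≤ F P → Effective G (moveChip P Q F)
  moveChip-effective {P} {Q} F≥0 1≤FP u = +-mono-≤ (⊝-point-effective P F≥0 1≤FP u) (·-effective 1 Q u)

  deg-moveChip : ∀ P Q F → deg G (moveChip P Q F) ≡ deg G F
  deg-moveChip P Q F = begin
    deg G (moveChip P Q F)                                  ≡⟨ Σᵥ≡sum (moveChip P Q F) ⟩
    sum (λ u → (F u - 1P u) + 1Q u)                         ≡⟨ ∑-distrib-+ (λ u → F u - 1P u) 1Q ⟩
    sum (λ u → F u - 1P u) + sum 1Q                         ≡⟨ cong (_+ sum 1Q) (∑-distrib-+ F (λ u → - 1P u)) ⟩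
    (sum F + sum (λ u → - 1P u)) + sum 1Q                   ≡⟨ cong (λ x → (sum F + x) + sum 1Q) (sum-neg 1P) ⟩
    (sum F - sum 1P) + sum 1Q                               ≡⟨ cong₂ (λ x y → (sum F - x) + y) (sum≡1 P) (sum≡1 Q) ⟩
    (sum F - + 1) + + 1                                     ≡⟨ lemma (sum F) ⟩
    sum F                                                   ≡⟨ Σᵥ≡sum F ⟨
    deg G F                                                 ∎
    where
    open ≡-Reasoning
    1P 1Q : Divisor G
    1P = pt P
    1Q = pt Q
    sum≡1 : ∀ R → sum (pt R) ≡ + 1
    sum≡1 R = trans (sym (Σᵥ≡sum (pt R))) (deg-· (+ 1) R)
    lemma : ∀ x → (x - + 1) + + 1 ≡ x
    lemma = solve-∀

  moveChip-at : ∀ {P Q F a} → Q ≢ P → F P ≡ + suc a → moveChip P Q F P ≡ + a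
  moveChip-at {P} {Q} {F} {a} Q≢P FP≡1+a =
    trans (cong₂ (λ x y → x - pt P P + y) FP≡1+a (·-other (+ 1) Q (Q≢P ∘ sym)))
      (trans (cong (λ c → + suc a - c + + 0) (·-self (+ 1) P)) (lemma (+ a)))
    where
    lemma : ∀ x → (+ 1 + x) - + 1 + + 0 ≡ x
    lemma = solve-∀

  winnable-moveChip : ∀ {P Q k F E} → _∼_ G E (_⊝_ G (_·_ G (+ k) P) F) →
                      Winnable (_⊝_ G (_·_ G (+ k - + 1) P) (moveChip P Q F)) → Winnable (_⊝_ G E (pt Q))
  winnable-moveChip {P} {Q} {k} {F} {E} (f , E-D≡Δf) =
    winnable-∼ {_⊝_ G (_·_ G (+ k - + 1) P) (moveChip P Q F)} ((λ v → - f v) , λ u →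
    trans (cong (λ c → (c - moveChip P Q F u) - (E u - pt Q u)) (·-pred (+ k) P u))
      (trans (lemma (E u) (_·_ G (+ k) P u) (pt P u) (pt Q u) (F u))
        (trans (cong -_ (E-D≡Δf u)) (sym (Δ-neg f u)))))
    where
    lemma : ∀ e p c q x → ((p - c) - ((x - c) + q)) - (e - q) ≡ - (e - (p - x))
    lemma = solve-∀

  -- Induction on F P: a chip of F at P is moved to a vertex Q where E − Q is unwinnable.
  descend : ∀ {P k m} → RankAtLeast G (_·_ G (+ k) P) m →
            ∀ a F → Effective G F → deg G F ≡ + m → F P ≡ + a →
            Winnable (_⊝_ G (_·_ G (+ k - + 1) P) F) ⊎ InHf G P k
  descend {P} {k} rank zero F F≥0 degF FP≡0 with rank F F≥0 degF
  ... | E , E≥0 , E∼D with + 1 ≤? E P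
  ...   | yes 1≤EP = inj₁ (winnable-lower {P} {k} {F} {E} E∼D (effective⇒winnable (⊝-point-effective P E≥0 1≤EP)))
  ...   | no  1≰EP = inj₂ (f , ΔfP≡-k , Δf≥0)
    where
    f : V → ℤ
    f = proj₁ E∼D
    E-D≡Δf : ∀ u → E u - (_·_ G (+ k) P u - F u) ≡ Δ G f u
    E-D≡Δf = proj₂ E∼D
    EP≡0 : E P ≡ + 0
    EP≡0 = 0≤i<1⇒i≡0 (E≥0 P) (≰⇒> 1≰EP)
    ΔfP≡-k : Δ G f P ≡ - + k
    ΔfP≡-k = begin
      Δ G f P                              ≡⟨ E-D≡Δf P ⟨
      E P - (_·_ G (+ k) P P - F P)        ≡⟨ cong₂ (λ e x → e - (_·_ G (+ k) P P - x)) EP≡0 FP≡0 ⟩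
      + 0 - (_·_ G (+ k) P P - + 0)        ≡⟨ cong (λ c → + 0 - (c - + 0)) (·-self (+ k) P) ⟩
      + 0 - (+ k - + 0)                    ≡⟨ lemma (+ k) ⟩
      - + k                                ∎
      where
      open ≡-Reasoning
      lemma : ∀ x → + 0 - (x - + 0) ≡ - x
      lemma = solve-∀
    Δf≥0 : ∀ Q → Q ≢ P → + 0 ≤ Δ G f Q
    Δf≥0 Q Q≢P = subst (+ 0 ≤_)
                   (trans (lemma (E Q) (F Q)) (trans (cong (λ c → E Q - (c - F Q)) (sym (·-other (+ k) P Q≢P))) (E-D≡Δf Q)))
                   (+-mono-≤ (E≥0 Q) (F≥0 Q))
      where
      lemma : ∀ e x → e + x ≡ e - (+ 0 - x)
      lemma = solve-∀
  descend {P} {k} rank (suc a) F F≥0 degF FP≡1+a with rank F F≥0 degF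
  ... | E , E≥0 , E∼D with reduce-or-escape P E E≥0
  ...   | inj₁ win = inj₁ (winnable-lower {P} {k} {F} {E} E∼D win)
  ...   | inj₂ (Q , Q≢P , unwinnable)
          with descend rank a (moveChip P Q F)
                  (moveChip-effective {P} {Q} F≥0 (subst (+ 1 ≤_) (sym FP≡1+a) (+≤+ (ℕ.s≤s ℕ.z≤n))))
                  (trans (deg-moveChip P Q F) degF) (moveChip-at {P} {Q} {F} Q≢P FP≡1+a)
  ...     | inj₁ win  = ⊥-elim (unwinnable (winnable-moveChip {P} {Q} {k} {F} {E} E∼D win))
  ...     | inj₂ pole = inj₂ pole

  -- Effective divisors of degree m take values in 0 … m, so they form a finite family.
  ∀effective-distrib-⊎ : ∀ m {A : Divisor G → Set} {B : Set} → (∀ {F F'} → (∀ u → F u ≡ F' u) → A F → A F') →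
                         (∀ F → Effective G F → deg G F ≡ + m → A F ⊎ B) →
                         (∀ F → Effective G F → deg G F ≡ + m → A F) ⊎ B
  ∀effective-distrib-⊎ m {A} {B} A-resp choose = map₁ from-Vec (∀All≤-distrib-⊎ m choose-Vec)
    where
    divisor : Vec ℕ n → Divisor G
    divisor t v = + Vec.lookup t v
    choose-Vec : ∀ t → All (ℕ._≤ m) t → (deg G (divisor t) ≡ + m → A (divisor t)) ⊎ B
    choose-Vec t _ with deg G (divisor t) ℤ.≟ + m
    ... | yes deg≡m = map₁ (λ a _ → a) (choose (divisor t) (λ _ → +≤+ ℕ.z≤n) deg≡m)
    ... | no  deg≢m = inj₁ λ deg≡m → ⊥-elim (deg≢m deg≡m)
    from-Vec : (∀ t → All (ℕ._≤ m) t → deg G (divisor t) ≡ + m → A (divisor t)) →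
               ∀ F → Effective G F → deg G F ≡ + m → A F
    from-Vec all F F≥0 degF = A-resp F≡ (all t t≤m (trans deg≡ degF))
      where
      t : Vec ℕ n
      t = Vec.tabulate (∣_∣ ∘ F)
      F≡ : ∀ u → divisor t u ≡ F u
      F≡ u = trans (cong +_ (lookup∘tabulate (∣_∣ ∘ F) u)) (0≤i⇒+∣i∣≡i (F≥0 u))
      deg≡ : deg G (divisor t) ≡ deg G F
      deg≡ = trans (Σᵥ≡sum (divisor t)) (trans (sum-cong-≗ F≡) (sym (Σᵥ≡sum F)))
      t≤m : All (ℕ._≤ m) t
      t≤m = tabulate⁺ λ u →
        drop‿+≤+ (subst₂ _≤_ (sym (0≤i⇒+∣i∣≡i (F≥0 u))) (trans (sym (Σᵥ≡sum F)) degF) (term≤sum F F≥0 u))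

  some-vertex : V
  some-vertex = Fin.fromℕ< (ℕ.≤-trans (ℕ.s≤s ℕ.z≤n) two≤n)

  nonempty-⊝ : ∀ {D F} → Effective G F → LinSysNonempty G (_⊝_ G D F) → LinSysNonempty G D
  nonempty-⊝ {D} {F} F≥0 (E , E≥0 , f , E-[D-F]≡Δf) =
    (λ u → E u + F u) , (λ u → +-mono-≤ (E≥0 u) (F≥0 u)) , f , λ u → trans (lemma (E u) (D u) (F u)) (E-[D-F]≡Δf u)
    where
    lemma : ∀ e d x → (e + x) - d ≡ e - (d - x)
    lemma = solve-∀

  rankAtLeast⇒nonempty : ∀ {D m} → RankAtLeast G D m → LinSysNonempty G D
  rankAtLeast⇒nonempty {m = m} rank =
    nonempty-⊝ (·-effective m some-vertex)
      (rank (_·_ G (+ m) some-vertex) (·-effective m some-vertex) (deg-· (+ m) some-vertex))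

  HasRank-≥ : ∀ {D r m} → HasRank G D r → RankAtLeast G D m → + m ≤ r
  HasRank-≥ (inj₁ (_ , empty))                  rank = ⊥-elim (empty (rankAtLeast⇒nonempty rank))
  HasRank-≥ (inj₂ (k , refl , _ , _ , maximal)) rank = +≤+ (maximal _ rank)

theoremA : (G : SimpleGraph) → (P : Vertex G) → (k : ℕ) → InHr G P k → InHf G P k
theoremA G P k (r₁ , r₀ , rank-kP , rank-[k-1]P , r₀<r₁) with rank-kP
... | inj₁ (_ , kP-empty) = ⊥-elim (kP-empty (winnable⇒nonempty G (effective⇒winnable G (·-effective G k P))))
... | inj₂ (k₁ , refl , _ , kP-rank , _)
        with ∀effective-distrib-⊎ G k₁ {λ F → Winnable G (_⊝_ G (_·_ G (+ k - + 1) P) F)}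
               (λ F≗F' → winnable-≗ G λ u → cong (_-_ (_·_ G (+ k - + 1) P u)) (F≗F' u))
               (λ F F≥0 degF → descend G kP-rank ∣ F P ∣ F F≥0 degF (sym (0≤i⇒+∣i∣≡i (F≥0 P))))
...   | inj₂ pole     = pole
...   | inj₁ winnable =
  ⊥-elim (<⇒≱ r₀<r₁ (HasRank-≥ G rank-[k-1]P λ F F≥0 degF → winnable⇒nonempty G (winnable F F≥0 degF)))
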